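{- Let $k, m, n$ be positive integers with $2 \leq k \leq m$ and $1 \leq n \leq (k-1)\binom{m}{k-1}$. For $1 \leq c \leq k-1$ put $U_{m,k,c} = \dfrac{(k-1)\binom{m}{c}}{\binom{k-1}{c}}$, and let $c$ be the least integer in $\{1, \ldots, k-1\}$ such that $n \leq U_{m,k,c}$. Then $$N(n,k,m) \;\geq\; nc - \left\lfloor \frac{(k-c)(U_{m,k,c}-n)}{m-k+1} \right\rfloor.$$
   Context: An $(n, N, k, m)$-CBC is a pair $(\mathcal{S}, \mathcal{X})$ where $\mathcal{S}$ is a set of $m$ elements and $\mathcal{X} = (X_1, \ldots, X_n)$ is a list (repetitions allowed) of $n$ subsets of $\mathcal{S}$ with $\sum_{j=1}^n |X_j| = N$, such that for every choice of $r$ distinct indices $i_1, \ldots, i_r$ with $1 \leq r \leq k$ one has $|X_{i_1} \cup \cdots \cup X_{i_r}| \geq r$. $N(n,k,m)$ denotes the minimum $N$ for which an $(n, N, k, m)$-CBC exists. -}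

module Defs where

open import Data.Nat using (ℕ; zero; suc; _+_; _*_; _∸_; _≤_; _/_)
open import Data.Nat.Combinatorics using (_C_)
open import Data.Fin using (Fin)
open import Data.Fin.Subset using (Subset; ⋃; ∣_∣)
open import Data.Fin.Subset.Properties using (_∈?_)
open import Data.List using (List; map; filter; allFin)
open import Data.Nat.ListAction using (sum)

⋃[_]_ : ∀ {n m} → Subset n → (Fin n → Subset m) → Subset m
⋃[ I ] X = ⋃ (map X (filter (λ i → i ∈? I) (allFin _)))

totalSize : ∀ {n m} → (Fin n → Subset m) → ℕ
totalSize {n} X = sum (map (λ j → ∣ X j ∣) (allFin n))

IsCBC : ∀ {n m} → ℕ → (Fin n → Subset m) → Set
IsCBC {n} {m} k X = (I : Subset n) → 1 ≤ ∣ I ∣ → ∣ I ∣ ≤ k → ∣ I ∣ ≤ ∣ ⋃[ I ] X ∣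

-- n ≤ U_{m,k,c} = (k-1) C(m,c) / C(k-1,c), cleared of the (positive) denominator.
_≤U[_,_,_] : ℕ → ℕ → ℕ → ℕ → Set
n ≤U[ m , k , c ] = n * ((k ∸ 1) C c) ≤ (k ∸ 1) * (m C c)

-- Natural-number floor division, with the convention a /′ 0 = 0
-- (only ever used with a nonzero divisor under the theorem's hypotheses).
_/′_ : ℕ → ℕ → ℕ
a /′ zero = 0
a /′ suc b = a / suc b

-- ⌊ (k-c)(U_{m,k,c} - n) / (m-k+1) ⌋
--   = ⌊ (k-c)((k-1)C(m,c) - n C(k-1,c)) / (C(k-1,c) (m-k+1)) ⌋
floorTerm : ℕ → ℕ → ℕ → ℕ → ℕ
floorTerm n k m c =
  ((k ∸ c) * ((k ∸ 1) * (m C c) ∸ n * ((k ∸ 1) C c)))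
    /′ (((k ∸ 1) C c) * (m ∸ k + 1))

-- Put K = k − 1, D = m − K, e = k − c and w = C(m − c, K − c).  A K-set containing
-- K + 1 of the X_i would violate the CBC condition, so double counting the pairs
-- (i, T) with X_i ⊆ T, |T| = K, gives  Σ_i C(m − |X_i|, K − |X_i|) ≤ K·C(m, K).
-- The function  s ↦ s·D·w + e·C(m − s, K − s)  is discretely convex with its
-- minimum at s = c, so summing it over the sizes |X_i| yields
-- n·(c·D·w + e·w) ≤ N·D·w + e·K·C(m, K).  Dividing by D·w and using
-- C(m, c)·C(m − c, K − c) = C(m, K)·C(K, c) gives N ≥ nc − e(U_{m,k,c} − n)/D.

module Submission where

open import Data.Bool using (true; false)
open import Data.Empty using (⊥-elim)
open import Data.Fin using (Fin; zero; suc)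
open import Data.Fin.Subset using (Subset; ∣_∣; _∈_; _⊆_; ⋃; ⊥; inside; outside)
open import Data.Fin.Subset.Properties using (_∈?_; _⊆?_; x∈p∪q⁻; ⊥⊆; p⊆q⇒∣p∣≤∣q∣; ∣p∣≤n; ∣⊥∣≡0; ∉⊥)
open import Data.List using (List; []; _∷_; _++_; map; filter; length; tabulate; allFin)
open import Data.List.Properties using (filter-++; length-++; map-++; length-tabulate; map-tabulate)
open import Data.List.Relation.Unary.All as All using (All; []; _∷_)
open import Data.List.Relation.Unary.All.Properties using (all-filter; map⁺)
open import Data.Nat
open import Data.Nat.Properties
open import Data.Nat.Combinatorics using (_C_; nCk+nC[k+1]≡[n+1]C[k+1]; nCn≡1)
open import Data.Nat.DivMod using (m*n/n≡m; /-monoˡ-≤)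
open import Data.Nat.ListAction using (sum)
open import Data.Nat.ListAction.Properties using (sum-++)
open import Data.Nat.Tactic.RingSolver using (solve-∀)
open import Data.Product using (∃-syntax; _×_; _,_)
open import Data.Sum using (inj₁; inj₂; [_,_])
open import Data.Vec using ([]; _∷_; here; there)
open import Function using (_∘_)
open import Relation.Binary.PropositionalEquality hiding ([_])
open import Relation.Nullary using (¬_; Dec; does; yes; no)

open import Defs

pascal : ℕ → ℕ → ℕ
pascal zero    y       = 1
pascal (suc x) zero    = 1
pascal (suc x) (suc y) = pascal x (suc y) + pascal (suc x) y

pascal≡C : ∀ x y → pascal x y ≡ (x + y) C x
pascal≡C zero    y       = refl
pascal≡C (suc x) zero    = sym (trans (cong (_C suc x) (+-identityʳ (suc x))) (nCn≡1 (suc x)))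
pascal≡C (suc x) (suc y) = begin
  pascal x (suc y) + pascal (suc x) y        ≡⟨ cong₂ _+_ (pascal≡C x (suc y)) (pascal≡C (suc x) y) ⟩
  (x + suc y) C x + suc (x + y) C suc x      ≡⟨ cong (λ z → z C x + suc (x + y) C suc x) (+-suc x y) ⟩
  suc (x + y) C x + suc (x + y) C suc x      ≡⟨ nCk+nC[k+1]≡[n+1]C[k+1] (suc (x + y)) x ⟩
  suc (suc (x + y)) C suc x                  ≡⟨ cong (λ z → suc z C suc x) (+-suc x y) ⟨
  (suc x + suc y) C suc x                    ∎
  where open ≡-Reasoning

pascal>0 : ∀ x y → pascal x y > 0
pascal>0 zero    y       = s≤s z≤n
pascal>0 (suc x) zero    = s≤s z≤n
pascal>0 (suc x) (suc y) = ≤-trans (pascal>0 x (suc y)) (m≤m+n _ _)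

pascal≤pascal-suc : ∀ x y → pascal x y ≤ pascal (suc x) y
pascal≤pascal-suc zero    zero    = ≤-refl
pascal≤pascal-suc (suc x) zero    = ≤-refl
pascal≤pascal-suc x       (suc y) = m≤m+n _ _

pascal-monoˡ-≤ : ∀ {x x′} y → x ≤ x′ → pascal x y ≤ pascal x′ y
pascal-monoˡ-≤ y x≤x′ = go (≤⇒≤′ x≤x′)
  where
  go : ∀ {x x′} → x ≤′ x′ → pascal x y ≤ pascal x′ y
  go ≤′-refl       = ≤-refl
  go (≤′-step x≤x′) = ≤-trans (go x≤x′) (pascal≤pascal-suc _ y)

pascal*!*!≡! : ∀ x y → pascal x y * (x ! * y !) ≡ (x + y) !
pascal*!*!≡! zero    y       = trans (+-identityʳ (y ! + 0)) (+-identityʳ (y !))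
pascal*!*!≡! (suc x) zero    = begin
  1 * (suc x ! * 1)  ≡⟨ trans (*-identityˡ _) (*-identityʳ _) ⟩
  suc x !            ≡⟨ cong _! (+-identityʳ (suc x)) ⟨
  (suc x + 0) !      ∎
  where open ≡-Reasoning
pascal*!*!≡! (suc x) (suc y) = begin
  (pascal x (suc y) + pascal (suc x) y) * (suc x ! * suc y !)
    ≡⟨ split (pascal x (suc y)) (pascal (suc x) y) (x !) (y !) x y ⟩
  suc x * (pascal x (suc y) * (x ! * suc y !)) + suc y * (pascal (suc x) y * (suc x ! * y !))
    ≡⟨ cong₂ (λ a b → suc x * a + suc y * b) (pascal*!*!≡! x (suc y)) (pascal*!*!≡! (suc x) y) ⟩
  suc x * (x + suc y) ! + suc y * suc (x + y) !
    ≡⟨ cong (λ z → suc x * z ! + suc y * suc (x + y) !) (+-suc x y) ⟩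
  suc x * suc (x + y) ! + suc y * suc (x + y) !
    ≡⟨ *-distribʳ-+ (suc (x + y) !) (suc x) (suc y) ⟨
  (suc x + suc y) * suc (x + y) !
    ≡⟨ cong (λ z → suc z * suc (x + y) !) (+-suc x y) ⟩
  suc (suc (x + y)) !
    ≡⟨ cong (λ z → suc z !) (+-suc x y) ⟨
  (suc x + suc y) ! ∎
  where
  open ≡-Reasoning
  split : ∀ a b fx fy x y → (a + b) * ((suc x * fx) * (suc y * fy))
                          ≡ suc x * (a * (fx * (suc y * fy))) + suc y * (b * ((suc x * fx) * fy))
  split = solve-∀

pascal-absorb : ∀ x y → suc x * pascal (suc x) y ≡ suc y * pascal x (suc y)
pascal-absorb x y = *-cancelʳ-≡ _ _ (x ! * y !) {{x !* y !≢0}} (begin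
  suc x * pascal (suc x) y * (x ! * y !)   ≡⟨ shuffle (suc x) (pascal (suc x) y) (x !) (y !) ⟩
  pascal (suc x) y * (suc x ! * y !)       ≡⟨ pascal*!*!≡! (suc x) y ⟩
  (suc x + y) !                            ≡⟨ cong _! (+-suc x y) ⟨
  (x + suc y) !                            ≡⟨ pascal*!*!≡! x (suc y) ⟨
  pascal x (suc y) * (x ! * suc y !)       ≡⟨ shuffle′ (suc y) (pascal x (suc y)) (x !) (y !) ⟩
  suc y * pascal x (suc y) * (x ! * y !)   ∎)
  where
  open ≡-Reasoning
  shuffle : ∀ s p a b → s * p * (a * b) ≡ p * ((s * a) * b)
  shuffle = solve-∀
  shuffle′ : ∀ s p a b → p * (a * (s * b)) ≡ s * p * (a * b)
  shuffle′ = solve-∀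

pascal-subset-of-subset : ∀ a b d → pascal a (b + d) * pascal b d ≡ pascal (a + b) d * pascal a b
pascal-subset-of-subset a b d = *-cancelʳ-≡ _ _ (a ! * b ! * d !) {{m*n≢0 _ _ {{a !* b !≢0}} {{d !≢0}}}} (begin
  pascal a (b + d) * pascal b d * (a ! * b ! * d !)     ≡⟨ shuffle (pascal a (b + d)) (pascal b d) (a !) (b !) (d !) ⟩
  pascal a (b + d) * (a ! * (pascal b d * (b ! * d !))) ≡⟨ cong (λ z → pascal a (b + d) * (a ! * z)) (pascal*!*!≡! b d) ⟩
  pascal a (b + d) * (a ! * (b + d) !)                  ≡⟨ pascal*!*!≡! a (b + d) ⟩
  (a + (b + d)) !                                       ≡⟨ cong _! (+-assoc a b d) ⟨
  (a + b + d) !                                         ≡⟨ pascal*!*!≡! (a + b) d ⟨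
  pascal (a + b) d * ((a + b) ! * d !)                  ≡⟨ cong (λ z → pascal (a + b) d * (z * d !)) (pascal*!*!≡! a b) ⟨
  pascal (a + b) d * (pascal a b * (a ! * b !) * d !)   ≡⟨ shuffle′ (pascal (a + b) d) (pascal a b) (a !) (b !) (d !) ⟩
  pascal (a + b) d * pascal a b * (a ! * b ! * d !)     ∎)
  where
  open ≡-Reasoning
  shuffle : ∀ p q x y z → p * q * (x * y * z) ≡ p * (x * (q * (y * z)))
  shuffle = solve-∀
  shuffle′ : ∀ p q x y z → p * (q * (x * y) * z) ≡ p * q * (x * y * z)
  shuffle′ = solve-∀

-- The number of t-subsets of an m-set containing a fixed i-subset:
-- (m − i) C (t − i) if i ≤ t, and 0 otherwise.
supersets : ℕ → ℕ → ℕ → ℕ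
supersets m       t       zero    = m C t
supersets zero    t       (suc i) = 0
supersets (suc m) zero    (suc i) = 0
supersets (suc m) (suc t) (suc i) = supersets m t i

supersets≡pascal : ∀ {m t} i {x d} → i + x ≡ t → t + d ≡ m → supersets m t i ≡ pascal x d
supersets≡pascal zero    {x} {d} refl refl = sym (pascal≡C x d)
supersets≡pascal (suc i)         refl refl = supersets≡pascal i refl refl

supersets-vanish : ∀ m {t i} → t < i → supersets m t i ≡ 0
supersets-vanish zero    {t}     {suc i} _         = refl
supersets-vanish (suc m) {zero}  {suc i} _         = refl
supersets-vanish (suc m) {suc t} {suc i} (s≤s t<i) = supersets-vanish m t<i

supersets-suc-zero : ∀ m i → supersets (suc m) 0 i ≡ supersets m 0 i
supersets-suc-zero m       zero    = refl
supersets-suc-zero zero    (suc i) = refl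
supersets-suc-zero (suc m) (suc i) = refl

supersets-pascal-rule : ∀ m t i → i ≤ m → supersets (suc m) (suc t) i ≡ supersets m (suc t) i + supersets m t i
supersets-pascal-rule m       t       zero    _          = trans (sym (nCk+nC[k+1]≡[n+1]C[k+1] m t)) (+-comm (m C t) _)
supersets-pascal-rule (suc m) zero    (suc i) _          = trans (supersets-suc-zero m i) (sym (+-identityʳ _))
supersets-pascal-rule (suc m) (suc t) (suc i) (s≤s i≤m) = supersets-pascal-rule m t i i≤m

count⊆ : ∀ {m} → Subset m → List (Subset m) → ℕ
count⊆ T L = length (filter (_⊆? T) L)

Sparse : ∀ {m} → ℕ → ℕ → List (Subset m) → Set
Sparse {m} t b L = (T : Subset m) → ∣ T ∣ ≡ t → count⊆ T L ≤ b

sizeSum : ∀ {m} → (ℕ → ℕ) → List (Subset m) → ℕ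
sizeSum f L = sum (map (λ Y → f ∣ Y ∣) L)

sizeSum-++ : ∀ {m} f (xs ys : List (Subset m)) → sizeSum f (xs ++ ys) ≡ sizeSum f xs + sizeSum f ys
sizeSum-++ f xs ys = trans (cong sum (map-++ (λ Y → f ∣ Y ∣) xs ys)) (sum-++ (map (λ Y → f ∣ Y ∣) xs) _)

tailsInside tailsOutside : ∀ {m} → List (Subset (suc m)) → List (Subset m)
tailsInside []                 = []
tailsInside ((inside  ∷ Y) ∷ L) = Y ∷ tailsInside L
tailsInside ((outside ∷ Y) ∷ L) = tailsInside L
tailsOutside []                 = []
tailsOutside ((inside  ∷ Y) ∷ L) = tailsOutside L
tailsOutside ((outside ∷ Y) ∷ L) = Y ∷ tailsOutside L

count⊆-inside : ∀ {m} (T : Subset m) L → count⊆ (inside ∷ T) L ≡ count⊆ T (tailsInside L) + count⊆ T (tailsOutside L)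
count⊆-inside T []                 = refl
count⊆-inside T ((inside  ∷ Y) ∷ L) with does (Y ⊆? T)
... | true  = cong suc (count⊆-inside T L)
... | false = count⊆-inside T L
count⊆-inside T ((outside ∷ Y) ∷ L) with does (Y ⊆? T)
... | true  = trans (cong suc (count⊆-inside T L)) (sym (+-suc _ _))
... | false = count⊆-inside T L

count⊆-outside : ∀ {m} (T : Subset m) L → count⊆ (outside ∷ T) L ≡ count⊆ T (tailsOutside L)
count⊆-outside T []                 = refl
count⊆-outside T ((inside  ∷ Y) ∷ L) = count⊆-outside T L
count⊆-outside T ((outside ∷ Y) ∷ L) with does (Y ⊆? T)
... | true  = cong suc (count⊆-outside T L)
... | false = count⊆-outside T L

sizeSum-zero : ∀ {m} (L : List (Subset (suc m))) → sizeSum (supersets (suc m) 0) L ≡ sizeSum (supersets m 0) (tailsOutside L)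
sizeSum-zero []                 = refl
sizeSum-zero ((inside  ∷ Y) ∷ L) = sizeSum-zero L
sizeSum-zero ((outside ∷ Y) ∷ L) = cong₂ _+_ (supersets-suc-zero _ ∣ Y ∣) (sizeSum-zero L)

sizeSum-suc : ∀ {m} t (L : List (Subset (suc m))) → let ins = tailsInside L; outs = tailsOutside L in
  sizeSum (supersets (suc m) (suc t)) L
    ≡ (sizeSum (supersets m t) ins + sizeSum (supersets m t) outs) + sizeSum (supersets m (suc t)) outs
sizeSum-suc t []                 = refl
sizeSum-suc t ((inside  ∷ Y) ∷ L) = trans (cong (supersets _ t ∣ Y ∣ +_) (sizeSum-suc t L)) (shuffle (supersets _ t ∣ Y ∣) _ _ _)
  where
  shuffle : ∀ a x y z → a + ((x + y) + z) ≡ ((a + x) + y) + z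
  shuffle = solve-∀
sizeSum-suc {m} t ((outside ∷ Y) ∷ L) =
  trans (cong₂ _+_ (supersets-pascal-rule m t ∣ Y ∣ (∣p∣≤n Y)) (sizeSum-suc t L))
    (shuffle (supersets m (suc t) ∣ Y ∣) (supersets m t ∣ Y ∣) (sizeSum (supersets m t) (tailsInside L)) _ _)
  where
  shuffle : ∀ a b x y z → (a + b) + ((x + y) + z) ≡ (x + (b + y)) + (a + z)
  shuffle = solve-∀

sizeSum-Subset0 : ∀ f (L : List (Subset 0)) → sizeSum f L ≡ length L * f 0
sizeSum-Subset0 f []       = refl
sizeSum-Subset0 f ([] ∷ L) = cong (f 0 +_) (sizeSum-Subset0 f L)

count⊆-Subset0 : ∀ (L : List (Subset 0)) → count⊆ [] L ≡ length L
count⊆-Subset0 []       = refl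
count⊆-Subset0 ([] ∷ L) = cong suc (count⊆-Subset0 L)

sparse-tails++ : ∀ {m t b} (L : List (Subset (suc m))) → Sparse (suc t) b L → Sparse t b (tailsInside L ++ tailsOutside L)
sparse-tails++ {b = b} L sparse T |T|≡t = begin
  count⊆ T (tailsInside L ++ tailsOutside L)           ≡⟨ cong length (filter-++ (_⊆? T) (tailsInside L) (tailsOutside L)) ⟩
  length (filter (_⊆? T) (tailsInside L) ++ filter (_⊆? T) (tailsOutside L))
                                                       ≡⟨ length-++ (filter (_⊆? T) (tailsInside L)) ⟩
  count⊆ T (tailsInside L) + count⊆ T (tailsOutside L) ≡⟨ count⊆-inside T L ⟨
  count⊆ (inside ∷ T) L                                ≤⟨ sparse (inside ∷ T) (cong suc |T|≡t) ⟩
  b                                                    ∎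
  where open ≤-Reasoning

sparse-tailsOutside : ∀ {m t b} (L : List (Subset (suc m))) → Sparse t b L → Sparse t b (tailsOutside L)
sparse-tailsOutside L sparse T |T|≡t = ≤-trans (≤-reflexive (sym (count⊆-outside T L))) (sparse (outside ∷ T) |T|≡t)

sizeSum-supersets≤ : ∀ m t {b} (L : List (Subset m)) → Sparse t b L → sizeSum (supersets m t) L ≤ b * (m C t)
sizeSum-supersets≤ zero    zero    {b} L sparse = begin
  sizeSum (supersets 0 0) L ≡⟨ sizeSum-Subset0 (supersets 0 0) L ⟩
  length L * 1              ≡⟨ cong (_* 1) (count⊆-Subset0 L) ⟨
  count⊆ [] L * 1           ≤⟨ *-monoˡ-≤ 1 (sparse [] refl) ⟩
  b * 1                     ∎
  where open ≤-Reasoning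
sizeSum-supersets≤ zero    (suc t) {b} L sparse = ≤-reflexive (begin-equality
  sizeSum (supersets 0 (suc t)) L ≡⟨ sizeSum-Subset0 (supersets 0 (suc t)) L ⟩
  length L * 0                    ≡⟨ *-zeroʳ (length L) ⟩
  0                               ≡⟨ *-zeroʳ b ⟨
  b * 0                           ∎)
  where open ≤-Reasoning
sizeSum-supersets≤ (suc m) zero    L sparse =
  ≤-trans (≤-reflexive (sizeSum-zero L)) (sizeSum-supersets≤ m zero (tailsOutside L) (sparse-tailsOutside L sparse))
sizeSum-supersets≤ (suc m) (suc t) {b} L sparse = begin
  sizeSum (supersets (suc m) (suc t)) L
    ≡⟨ sizeSum-suc t L ⟩
  (sizeSum (supersets m t) ins + sizeSum (supersets m t) outs) + sizeSum (supersets m (suc t)) outs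
    ≡⟨ cong (_+ sizeSum (supersets m (suc t)) outs) (sizeSum-++ (supersets m t) ins outs) ⟨
  sizeSum (supersets m t) (ins ++ outs) + sizeSum (supersets m (suc t)) outs
    ≤⟨ +-mono-≤ (sizeSum-supersets≤ m t (ins ++ outs) (sparse-tails++ L sparse))
                (sizeSum-supersets≤ m (suc t) outs (sparse-tailsOutside L sparse)) ⟩
  b * (m C t) + b * (m C suc t)
    ≡⟨ *-distribˡ-+ b _ _ ⟨
  b * (m C t + m C suc t)
    ≡⟨ cong (b *_) (nCk+nC[k+1]≡[n+1]C[k+1] m t) ⟩
  b * (suc m C suc t) ∎
  where
  open ≤-Reasoning
  ins = tailsInside L
  outs = tailsOutside L

select-indices : ∀ {a p} {A : Set a} {P : A → Set p} (P? : ∀ x → Dec (P x)) {n} (f : Fin n → A) {r} →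
  r ≤ length (filter P? (tabulate f)) → ∃[ I ] ∣ I ∣ ≡ r × (∀ {i} → i ∈ I → P (f i))
select-indices P? {n} f {zero} _ = ⊥ , ∣⊥∣≡0 n , ⊥-elim ∘ ∉⊥
select-indices P? {suc n} f {suc r} r≤ with P? (f zero)
... | yes Pf0 with I , |I|≡r , P∘f ← select-indices P? (f ∘ suc) (s≤s⁻¹ r≤) =
  inside ∷ I , cong suc |I|≡r , λ { here → Pf0 ; (there i∈I) → P∘f i∈I }
... | no _    with I , |I|≡r , P∘f ← select-indices P? (f ∘ suc) r≤ =
  outside ∷ I , |I|≡r , λ { (there i∈I) → P∘f i∈I }

⋃-least : ∀ {m} {T : Subset m} (L : List (Subset m)) → All (_⊆ T) L → ⋃ L ⊆ T
⋃-least []      []            = ⊥⊆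
⋃-least (Y ∷ L) (Y⊆T ∷ L⊆T) x∈ = [ Y⊆T , ⋃-least L L⊆T ] (x∈p∪q⁻ Y (⋃ L) x∈)

CBC⇒sparse : ∀ {n m} K (X : Fin n → Subset m) → IsCBC (suc K) X → Sparse K K (tabulate X)
CBC⇒sparse {n} K X cbc T |T|≡K = ≮⇒≥ λ K<count →
  let I , |I|≡1+K , X[I]⊆T = select-indices (_⊆? T) X K<count in
  1+n≰n (begin
    suc K         ≡⟨ |I|≡1+K ⟨
    ∣ I ∣         ≤⟨ cbc I (subst (1 ≤_) (sym |I|≡1+K) (s≤s z≤n)) (≤-reflexive |I|≡1+K) ⟩
    ∣ ⋃[ I ] X ∣  ≤⟨ p⊆q⇒∣p∣≤∣q∣ (⋃-least _ (map⁺ (All.map X[I]⊆T (all-filter (_∈? I) (allFin n))))) ⟩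
    ∣ T ∣         ≡⟨ |T|≡K ⟩
    K             ∎)
  where open ≤-Reasoning

valley-minimum : ∀ (h : ℕ → ℕ) c → (∀ i → suc i ≤ c → h (suc i) ≤ h i) → (∀ i → c ≤ i → h i ≤ h (suc i))
                 → ∀ i → h c ≤ h i
valley-minimum h c down up i with ≤-total c i
... | inj₁ c≤i = ascend (≤⇒≤′ c≤i)
  where
  ascend : ∀ {i} → c ≤′ i → h c ≤ h i
  ascend ≤′-refl         = ≤-refl
  ascend (≤′-step c≤′i) = ≤-trans (ascend c≤′i) (up _ (≤′⇒≤ c≤′i))
... | inj₂ i≤c = descend (≤⇒≤′ i≤c) ≤-refl
  where
  descend : ∀ {i j} → i ≤′ j → j ≤ c → h j ≤ h i
  descend ≤′-refl         _     = ≤-refl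
  descend (≤′-step i≤′j) 1+j≤c = ≤-trans (down _ 1+j≤c) (descend i≤′j (≤-trans (n≤1+n _) 1+j≤c))

slope-down : ∀ i {X e δ a b} → b ≡ δ + a → X ≤ e * δ → suc i * X + e * a ≤ i * X + e * b
slope-down i {X} {e} {δ} {a} refl X≤eδ = begin
  (X + i * X) + e * a       ≡⟨ cong (_+ e * a) (+-comm X (i * X)) ⟩
  (i * X + X) + e * a       ≡⟨ +-assoc (i * X) X (e * a) ⟩
  i * X + (X + e * a)       ≤⟨ +-monoʳ-≤ (i * X) (+-monoˡ-≤ (e * a) X≤eδ) ⟩
  i * X + (e * δ + e * a)   ≡⟨ cong (i * X +_) (*-distribˡ-+ e δ a) ⟨
  i * X + e * (δ + a)       ∎
  where open ≤-Reasoning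

slope-up : ∀ i {X e δ a b} → b ≡ δ + a → e * δ ≤ X → i * X + e * b ≤ suc i * X + e * a
slope-up i {X} {e} {δ} {a} refl eδ≤X = begin
  i * X + e * (δ + a)       ≡⟨ cong (i * X +_) (*-distribˡ-+ e δ a) ⟩
  i * X + (e * δ + e * a)   ≤⟨ +-monoʳ-≤ (i * X) (+-monoˡ-≤ (e * a) eδ≤X) ⟩
  i * X + (X + e * a)       ≡⟨ +-assoc (i * X) X (e * a) ⟨
  (i * X + X) + e * a       ≡⟨ cong (_+ e * a) (+-comm (i * X) X) ⟩
  (X + i * X) + e * a       ∎
  where open ≤-Reasoning

-- h (suc i) − h i = D·w − e·δ i, where D·w = e·τ and δ i = C(m − 1 − i, K − i)
-- decreases in i from δ (c − 1) = τ to δ c = C(j + d, j) ≤ τ.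
weight-minimal : ∀ c₀ j d i → let c = suc c₀; D = suc d; w = pascal j D; e = suc j in
  c * (D * w) + e * w ≤ i * (D * w) + e * supersets (c + j + D) (c + j) i
weight-minimal c₀ j d i = subst (λ z → c * (D * w) + e * z ≤ h i) g[c]≡w (valley-minimum h c down up i)
  where
  c = suc c₀
  K = c + j
  D = suc d
  m′ = c₀ + j + D
  w = pascal j D
  e = suc j
  τ = pascal (suc j) d
  g δ : ℕ → ℕ
  g = supersets (suc m′) K
  δ = supersets m′ K
  h : ℕ → ℕ
  h i = i * (D * w) + e * g i

  g[c]≡w : g c ≡ w
  g[c]≡w = supersets≡pascal c refl refl
  Dw≡eτ : D * w ≡ e * τ
  Dw≡eτ = sym (pascal-absorb j d)
  δ≡pascal : ∀ i {x} → i + x ≡ K → δ i ≡ pascal x d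
  δ≡pascal i i+x≡K = supersets≡pascal i i+x≡K (sym (+-suc (c₀ + j) d))
  g-step : ∀ i → i ≤ m′ → g i ≡ δ i + g (suc i)
  g-step i = supersets-pascal-rule m′ (c₀ + j) i
  K≤m′ : K ≤ m′
  K≤m′ = ≤-trans (s≤s (m≤m+n (c₀ + j) d)) (≤-reflexive (sym (+-suc (c₀ + j) d)))

  down : ∀ i → suc i ≤ c → h (suc i) ≤ h i
  down i (s≤s i≤c₀) with y , i+y≡c₀ ← m≤n⇒∃[o]m+o≡n i≤c₀ = slope-down i {e = e} {δ i} {g (suc i)} (g-step i i≤m′) (begin
    D * w                    ≡⟨ Dw≡eτ ⟩
    e * τ                    ≤⟨ *-monoʳ-≤ e (pascal-monoˡ-≤ d (m≤n+m (suc j) y)) ⟩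
    e * pascal (y + suc j) d ≡⟨ cong (e *_) (δ≡pascal i i+x≡K) ⟨
    e * δ i                  ∎)
    where
    open ≤-Reasoning
    i≤m′ : i ≤ m′
    i≤m′ = ≤-trans i≤c₀ (≤-trans (m≤m+n c₀ j) (m≤m+n (c₀ + j) D))
    i+x≡K : i + (y + suc j) ≡ K
    i+x≡K = trans (sym (+-assoc i y (suc j))) (trans (cong (_+ suc j) i+y≡c₀) (+-suc c₀ j))

  up : ∀ i → c ≤ i → h i ≤ h (suc i)
  up i c≤i with i ≤? K
  ... | yes i≤K with x , i+x≡K ← m≤n⇒∃[o]m+o≡n i≤K = slope-up i {e = e} {δ i} {g (suc i)} (g-step i (≤-trans i≤K K≤m′)) (begin
    e * δ i        ≡⟨ cong (e *_) (δ≡pascal i i+x≡K) ⟩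
    e * pascal x d ≤⟨ *-monoʳ-≤ e (pascal-monoˡ-≤ d (m≤n⇒m≤1+n x≤j)) ⟩
    e * τ          ≡⟨ Dw≡eτ ⟨
    D * w          ∎)
    where
    open ≤-Reasoning
    x≤j : x ≤ j
    x≤j = +-cancelˡ-≤ c x j (≤-trans (+-monoˡ-≤ x c≤i) (≤-reflexive i+x≡K))
  ... | no i≰K = +-mono-≤ (m≤n+m (i * (D * w)) (D * w)) (begin
    e * g i       ≡⟨ cong (e *_) (supersets-vanish (suc m′) (≰⇒> i≰K)) ⟩
    e * 0         ≤⟨ *-monoʳ-≤ e z≤n ⟩
    e * g (suc i) ∎)
    where open ≤-Reasoning

length*≤sizeSum : ∀ {m a X e} {f : ℕ → ℕ} (L : List (Subset m)) → (∀ i → a ≤ i * X + e * f i) →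
  length L * a ≤ sizeSum (λ i → i) L * X + e * sizeSum f L
length*≤sizeSum []      _  = z≤n
length*≤sizeSum {a = a} {X} {e} {f} (Y ∷ L) a≤ = begin
  a + length L * a
    ≤⟨ +-mono-≤ (a≤ ∣ Y ∣) (length*≤sizeSum {e = e} {f} L a≤) ⟩
  (∣ Y ∣ * X + e * f ∣ Y ∣) + (sizeSum (λ i → i) L * X + e * sizeSum f L)
    ≡⟨ shuffle ∣ Y ∣ (sizeSum (λ i → i) L) X e (f ∣ Y ∣) (sizeSum f L) ⟩
  (∣ Y ∣ + sizeSum (λ i → i) L) * X + e * (f ∣ Y ∣ + sizeSum f L) ∎
  where
  open ≤-Reasoning
  shuffle : ∀ y s X e fy fs → (y * X + e * fy) + (s * X + e * fs) ≡ (y + s) * X + e * (fy + fs)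
  shuffle = solve-∀

totalSize≡sizeSum : ∀ {n m} (X : Fin n → Subset m) → totalSize X ≡ sizeSum (λ i → i) (tabulate X)
totalSize≡sizeSum {n} X = trans (cong sum (map-tabulate (λ i → i) (λ j → ∣ X j ∣)))
                                (sym (cong sum (map-tabulate X ∣_∣)))

totalSize-weighted-bound : ∀ {n} c₀ j d (X : Fin n → Subset (suc c₀ + j + suc d)) → IsCBC (suc (suc c₀ + j)) X →
  let c = suc c₀; K = c + j; D = suc d; m = K + D; w = pascal j D; e = suc j in
  n * (c * (D * w) + e * w) ≤ totalSize X * (D * w) + e * (K * (m C K))
totalSize-weighted-bound {n} c₀ j d X cbc = begin
  n * a
    ≡⟨ cong (_* a) (length-tabulate X) ⟨
  length L * a
    ≤⟨ length*≤sizeSum {e = e} {supersets m K} L (weight-minimal c₀ j d) ⟩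
  sizeSum (λ i → i) L * (D * w) + e * sizeSum (supersets m K) L
    ≤⟨ +-mono-≤ (≤-reflexive (cong (_* (D * w)) (sym (totalSize≡sizeSum X))))
                (*-monoʳ-≤ e (sizeSum-supersets≤ m K L (CBC⇒sparse K X cbc))) ⟩
  totalSize X * (D * w) + e * (K * (m C K)) ∎
  where
  open ≤-Reasoning
  c = suc c₀
  K = c + j
  D = suc d
  m = K + D
  w = pascal j D
  e = suc j
  a = c * (D * w) + e * w
  L = tabulate X

rescale-bound : ∀ {n c e K S D w A G B} → w > 0 → A * w ≡ G * B → n * B ≤ K * A →
  n * (c * (D * w) + e * w) ≤ S * (D * w) + e * (K * G) →
  n * c * (B * D) ≤ S * (B * D) + e * (K * A ∸ n * B)
rescale-bound {n} {c} {e} {K} {S} {D} {w} {A} {G} {B} w>0 Aw≡GB nB≤KA bound =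
  +-cancelʳ-≤ (e * (n * B)) _ _ (begin
    n * c * (B * D) + e * (n * B)                   ≤⟨ *-cancelʳ-≤ _ _ w {{>-nonZero w>0}} scaled ⟩
    S * (B * D) + e * (K * A)                       ≡⟨ cong (λ z → S * (B * D) + e * z) (m∸n+n≡m nB≤KA) ⟨
    S * (B * D) + e * (K * A ∸ n * B + n * B)       ≡⟨ split-last (S * (B * D)) e (K * A ∸ n * B) (n * B) ⟩
    S * (B * D) + e * (K * A ∸ n * B) + e * (n * B) ∎)
  where
  open ≤-Reasoning
  split-last : ∀ a e x y → a + e * (x + y) ≡ a + e * x + e * y
  split-last = solve-∀
  scaled : (n * c * (B * D) + e * (n * B)) * w ≤ (S * (B * D) + e * (K * A)) * w
  scaled = begin
    (n * c * (B * D) + e * (n * B)) * w     ≡⟨ l₁ n c B D e w ⟩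
    B * (n * (c * (D * w) + e * w))         ≤⟨ *-monoʳ-≤ B bound ⟩
    B * (S * (D * w) + e * (K * G))         ≡⟨ l₂ B S D w e K G ⟩
    S * (B * D) * w + e * K * (G * B)       ≡⟨ cong (λ z → S * (B * D) * w + e * K * z) Aw≡GB ⟨
    S * (B * D) * w + e * K * (A * w)       ≡⟨ l₃ S B D w e K A ⟩
    (S * (B * D) + e * (K * A)) * w         ∎
    where
    l₁ : ∀ n c B D e w → (n * c * (B * D) + e * (n * B)) * w ≡ B * (n * (c * (D * w) + e * w))
    l₁ = solve-∀
    l₂ : ∀ B S D w e K G → B * (S * (D * w) + e * (K * G)) ≡ S * (B * D) * w + e * K * (G * B)
    l₂ = solve-∀
    l₃ : ∀ S B D w e K A → S * (B * D) * w + e * K * (A * w) ≡ (S * (B * D) + e * (K * A)) * w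
    l₃ = solve-∀

m*o≤n*o+p⇒m∸p/′o≤n : ∀ {m n o p} → o > 0 → m * o ≤ n * o + p → m ∸ p /′ o ≤ n
m*o≤n*o+p⇒m∸p/′o≤n {m} {n} {suc o} {p} _ mo≤no+p = m≤n+o⇒m∸n≤o m q (begin
  m             ≤⟨ m≤n+m∸n m n ⟩
  n + (m ∸ n)   ≤⟨ +-monoʳ-≤ n m∸n≤q ⟩
  n + q         ≡⟨ +-comm n q ⟩
  q + n         ∎)
  where
  open ≤-Reasoning
  q = p / suc o
  m∸n≤q : m ∸ n ≤ q
  m∸n≤q = begin
    m ∸ n                      ≡⟨ m*n/n≡m (m ∸ n) (suc o) ⟨
    (m ∸ n) * suc o / suc o    ≤⟨ /-monoˡ-≤ (suc o) (begin
      (m ∸ n) * suc o              ≡⟨ *-distribʳ-∸ (suc o) m n ⟩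
      m * suc o ∸ n * suc o        ≤⟨ m≤n+o⇒m∸n≤o (m * suc o) (n * suc o) mo≤no+p ⟩
      p                            ∎) ⟩
    q                          ∎

choose-subset-of-subset : ∀ a b d → ((a + b + d) C a) * pascal b d ≡ ((a + b + d) C (a + b)) * ((a + b) C a)
choose-subset-of-subset a b d = begin
  ((a + b + d) C a) * pascal b d             ≡⟨ cong (λ z → (z C a) * pascal b d) (+-assoc a b d) ⟩
  ((a + (b + d)) C a) * pascal b d           ≡⟨ cong (_* pascal b d) (pascal≡C a (b + d)) ⟨
  pascal a (b + d) * pascal b d              ≡⟨ pascal-subset-of-subset a b d ⟩
  pascal (a + b) d * pascal a b              ≡⟨ cong₂ _*_ (pascal≡C (a + b) d) (pascal≡C a b) ⟩
  ((a + b + d) C (a + b)) * ((a + b) C a)    ∎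
  where open ≡-Reasoning

floorTerm≡ : ∀ n c j d → let K = c + j; m = K + suc d; A = m C c; B = K C c in
  floorTerm n (suc K) m c ≡ (suc j * (K * A ∸ n * B)) /′ (B * suc d)
floorTerm≡ n c j d = cong₂ (λ e D → (e * (K * A ∸ n * B)) /′ (B * D)) k∸c≡1+j m∸k+1≡1+d
  where
  K = c + j
  m = K + suc d
  A = m C c
  B = K C c
  k∸c≡1+j : suc K ∸ c ≡ suc j
  k∸c≡1+j = trans (cong (_∸ c) (sym (+-suc c j))) (m+n∸m≡n c (suc j))
  m∸k+1≡1+d : m ∸ suc K + 1 ≡ suc d
  m∸k+1≡1+d = trans (cong (λ z → z ∸ suc K + 1) (+-suc K d)) (trans (cong (_+ 1) (m+n∸m≡n K d)) (+-comm d 1))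

theorem3p1 : (k m n c : ℕ) → 2 ≤ k → k ≤ m → 1 ≤ n → n ≤ (k ∸ 1) * (m C (k ∸ 1))
    → 1 ≤ c → c ≤ k ∸ 1 → n ≤U[ m , k , c ]
    → ((c′ : ℕ) → 1 ≤ c′ → c′ < c → ¬ (n ≤U[ m , k , c′ ]))
    → (X : Fin n → Subset m) → IsCBC k X
    → n * c ∸ floorTerm n k m c ≤ totalSize X
theorem3p1 (suc K) m n (suc c₀) _ k≤m _ _ _ c≤K n≤U _ X cbc
  with j , refl ← m≤n⇒∃[o]m+o≡n c≤K
  with d , 1+K+d≡m ← m≤n⇒∃[o]m+o≡n k≤m
  with refl ← trans (+-suc K d) 1+K+d≡m = begin
    n * c ∸ floorTerm n (suc K) m c                  ≡⟨ cong (n * c ∸_) (floorTerm≡ n c j d) ⟩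
    n * c ∸ (suc j * (K * A ∸ n * B)) /′ (B * suc d) ≤⟨ m*o≤n*o+p⇒m∸p/′o≤n B*D>0 bound ⟩
    totalSize X                                      ∎
  where
  open ≤-Reasoning
  c = suc c₀
  A = m C c
  B = K C c
  bound : n * c * (B * suc d) ≤ totalSize X * (B * suc d) + suc j * (K * A ∸ n * B)
  bound = rescale-bound {n} {c} {suc j} {K} {totalSize X} {suc d} {pascal j (suc d)} {A} {m C K} {B}
            (pascal>0 j (suc d)) (choose-subset-of-subset c j (suc d)) n≤U (totalSize-weighted-bound c₀ j d X cbc)
  B*D>0 : B * suc d > 0
  B*D>0 = *-mono-< {0} {B} {0} (subst (_> 0) (pascal≡C c j) (pascal>0 c j)) (s≤s z≤n)
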